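{- Let $G$ be a group of size $|G|=n$ and let $S\subseteq G$ be a dissociated subset. Then there exists a properly edge-coloured $|S|$-regular graph on $2n$ vertices without a rainbow cycle. Furthermore, if every element of $S$ has even order in $G$, then there also exists a properly edge-coloured $|S|$-regular graph on $n$ vertices without a rainbow cycle.
   Context: For a group $G$ with identity $e$, a subset $S\subseteq G$ is dissociated if there is no solution to $g_1^{\varepsilon_1}\cdots g_m^{\varepsilon_m}=e$ with $m\ge1$, distinct $g_1,\dots,g_m\in S$ and $\varepsilon_1,\dots,\varepsilon_m\in\{ -1,1\}$. A proper edge-colouring assigns distinct colours to any two distinct edges sharing a vertex; a cycle is rainbow if no colour appears on two of its edges. -}

module Defs where

open import Level using (Level; 0ℓ)
open import Data.Nat using (ℕ; zero; suc; _≤_; _<_; _*_)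
open import Data.Nat.Divisibility using (_∣_)
open import Data.Fin using (Fin)
open import Data.Fin.Subset using (Subset; _∈_; ∣_∣)
open import Data.Bool using (Bool; true; false; if_then_else_)
open import Data.List using (List; []; _∷_; map; length)
open import Data.List.Relation.Unary.All using (All)
open import Data.List.Relation.Unary.Unique.Propositional using (Unique)
open import Data.Product using (_×_; _,_; proj₁; proj₂; ∃; ∃-syntax)
open import Relation.Nullary using (¬_)
open import Relation.Binary.PropositionalEquality as ≡ using (_≡_; _≢_)
open import Algebra.Bundles using (Group)
open import Function.Bundles using (Inverse)

-- Finite groups: a group G together with an enumeration of its
-- elements, i.e. a bijection (setoid inverse) Fin n ↔ Carrier G.
-- Hence |G| = n.

Enumeration : ∀ {c ℓ} → Group c ℓ → ℕ → Set _
Enumeration G n = Inverse (≡.setoid (Fin n)) (Group.setoid G)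

module _ {c ℓ} (G : Group c ℓ) {n : ℕ} (enum : Enumeration G n) where
  open Group G
  open Inverse enum using (to)

  signedElem : Fin n × Bool → Carrier
  signedElem (i , true)  = to i
  signedElem (i , false) = to i ⁻¹

  signedProduct : List (Fin n × Bool) → Carrier
  signedProduct []       = ε
  signedProduct (x ∷ xs) = signedElem x ∙ signedProduct xs

  Dissociated : Subset n → Set _
  Dissociated S =
    (xs : List (Fin n × Bool)) → 1 ≤ length xs →
    Unique (map proj₁ xs) → All (λ x → proj₁ x ∈ S) xs →
    ¬ (signedProduct xs ≈ ε)

  pow : Carrier → ℕ → Carrier
  pow g zero    = ε
  pow g (suc k) = g ∙ pow g k

  HasOrder : Carrier → ℕ → Set _
  HasOrder g k = 1 ≤ k × pow g k ≈ ε × (∀ j → 1 ≤ j → j < k → ¬ (pow g j ≈ ε))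

  HasEvenOrder : Carrier → Set _
  HasEvenOrder g = ∃[ k ] (HasOrder g k × 2 ∣ k)

  AllEvenOrder : Subset n → Set _
  AllEvenOrder S = ∀ i → i ∈ S → HasEvenOrder (to i)

record ColouredGraph (N : ℕ) : Set where
  field
    adj        : Fin N → Subset N
    colour     : Fin N → Fin N → ℕ
    adj-sym    : ∀ {u v} → v ∈ adj u → u ∈ adj v
    adj-irrefl : ∀ {v} → ¬ (v ∈ adj v)
    colour-sym : ∀ {u v} → v ∈ adj u → colour u v ≡ colour v u

module _ {N : ℕ} (Γ : ColouredGraph N) where
  open ColouredGraph Γ

  ProperlyColoured : Set
  ProperlyColoured = ∀ {u v w} → v ∈ adj u → w ∈ adj u → v ≢ w →
                     colour u v ≢ colour u w

  Regular : ℕ → Set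
  Regular d = ∀ v → ∣ adj v ∣ ≡ d

  cyclicPairs : List (Fin N) → List (Fin N × Fin N)
  cyclicPairs []       = []
  cyclicPairs (v ∷ vs) = go v (v ∷ vs)
    where
    go : Fin N → List (Fin N) → List (Fin N × Fin N)
    go first []           = []
    go first (x ∷ [])     = (x , first) ∷ []
    go first (x ∷ y ∷ ys) = (x , y) ∷ go first (y ∷ ys)

  IsCycle : List (Fin N) → Set
  IsCycle vs = 3 ≤ length vs × Unique vs ×
               All (λ e → proj₂ e ∈ adj (proj₁ e)) (cyclicPairs vs)

  IsRainbow : List (Fin N) → Set
  IsRainbow vs = Unique (map (λ e → colour (proj₁ e) (proj₂ e)) (cyclicPairs vs))

  NoRainbowCycle : Set
  NoRainbowCycle = ∀ vs → IsCycle vs → ¬ IsRainbow vs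

GoodGraph : ℕ → ℕ → Set
GoodGraph N d = ∃[ Γ ] (ProperlyColoured {N} Γ × Regular Γ d × NoRainbowCycle Γ)

-- Both graphs are built from |S| perfect matchings, one for each generator sᵢ ∈ S,
-- together with a labelling of the vertices by elements of G such that crossing an
-- edge of the i-th matching multiplies the label on the right by sᵢ or sᵢ⁻¹.
-- Colouring each edge by its generator gives a proper |S|-regular colouring, and
-- the labels telescope around any cycle: a rainbow cycle would exhibit a product of
-- distinct generators, with signs, equal to e, contradicting dissociativity.
-- On the 2n vertices (b , h) ∈ Bool × G one matches (true , h) with (false , h sᵢ).
-- When sᵢ has even order every coset h⟨sᵢ⟩ is an even cycle under right
-- multiplication by sᵢ, so G itself can be 2-coloured alternately along these
-- cycles, and h is matched with h sᵢ or h sᵢ⁻¹ according to its colour.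

module Submission where

open import Defs
open import Level using (_⊔_)
open import Algebra.Bundles using (Group)
open import Data.Bool using (Bool; true; false; not)
open import Data.Bool.Properties using (not-involutive; not-¬)
open import Data.Empty using (⊥-elim)
open import Data.Fin using (Fin; zero; suc; toℕ; _≟_)
open import Data.Fin.Properties using (any?; suc-injective; toℕ-injective; 0≢1+n; *↔×; 2↔Bool)
open import Data.Fin.Subset using (Subset; _∈_; ∣_∣)
open import Data.Fin.Subset.Properties using (_∈?_)
open import Data.List using (List; []; _∷_; length; drop; map)
open import Data.List.Relation.Unary.All as All using (All; []; _∷_)
open import Data.List.Relation.Unary.Unique.Propositional using (Unique)
import Data.List.Relation.Unary.Unique.Propositional.Properties as Unique
open import Data.Nat using (ℕ; zero; suc; pred; _+_; _*_; _∸_; _≤_; _<_; _<?_; z≤n; s≤s; parity)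
open import Data.Nat.Divisibility using (_∣_; divides)
open import Data.Nat.Properties
  using ( +-0-commutativeMonoid; ≤-refl; ≤-antisym; <-cmp; <⇒≤; ≮⇒≥; ≤-<-trans; <-≤-trans
        ; m≤n⇒m≤1+n; m≤n⇒m<n∨m≡n; m∸n≤m; m<n⇒0<n∸m; m+[n∸m]≡n)
open import Data.Parity as ℙ using (Parity; 0ℙ; 1ℙ)
open import Data.Parity.Properties using (suc-homo-⁻¹; *-homo-*; *-zeroʳ)
open import Data.Product using (_×_; _,_; proj₁; proj₂; ∃-syntax)
open import Data.Product.Function.NonDependent.Propositional using (_×-↔_)
open import Data.Sum using (inj₁; inj₂)
open import Data.Vec using ([]; _∷_; tabulate)
open import Data.Vec.Properties using (lookup∘tabulate; []=⇒lookup; lookup⇒[]=)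
open import Function using (_∘_)
open import Function.Bundles using (Inverse; _↔_)
open import Function.Properties.Inverse using (↔-refl; ↔-trans)
open import Relation.Binary.Definitions using (tri<; tri≈; tri>)
open import Relation.Binary.PropositionalEquality as ≡ using (_≡_; _≢_; refl; cong; _≗_)
open import Relation.Nullary using (¬_; Dec; yes; no; does; _×-dec_)
open import Relation.Nullary.Decidable using (dec-true; dec-false)
open import Relation.Unary using (Pred; Decidable)

module Counting where
  open ≡ using (sym; trans; module ≡-Reasoning)
  open import Algebra.Properties.CommutativeMonoid.Sum +-0-commutativeMonoid
    using (sum-syntax; ∑-comm; sum-cong-≗; sum-replicate-zero)

  𝟙 : Bool → ℕ
  𝟙 true  = 1
  𝟙 false = 0

  ∣p∣≡∑ : ∀ {n} (p : Subset n) → ∣ p ∣ ≡ ∑[ i < n ] 𝟙 (does (i ∈? p))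
  ∣p∣≡∑ []          = refl
  ∣p∣≡∑ (true ∷ p)  = cong suc (∣p∣≡∑ p)
  ∣p∣≡∑ (false ∷ p) = ∣p∣≡∑ p

  ∣tabulate∣≡∑ : ∀ {n} (f : Fin n → Bool) → ∣ tabulate f ∣ ≡ ∑[ i < n ] 𝟙 (f i)
  ∣tabulate∣≡∑ {zero}  f = refl
  ∣tabulate∣≡∑ {suc n} f with f zero
  ... | true  = cong suc (∣tabulate∣≡∑ (f ∘ suc))
  ... | false = ∣tabulate∣≡∑ (f ∘ suc)

  ∈tabulate⇒ : ∀ {n} {f : Fin n → Bool} {i} → i ∈ tabulate f → f i ≡ true
  ∈tabulate⇒ {f = f} {i} i∈ = trans (sym (lookup∘tabulate f i)) ([]=⇒lookup i∈)

  ⇒∈tabulate : ∀ {n} {f : Fin n → Bool} {i} → f i ≡ true → i ∈ tabulate f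
  ⇒∈tabulate {f = f} {i} fi = lookup⇒[]= i (tabulate f) (trans (lookup∘tabulate f i) fi)

  AtMostOne : ∀ {n ℓ} → Pred (Fin n) ℓ → Set ℓ
  AtMostOne P = ∀ {i j} → P i → P j → i ≡ j

  𝟙-any?≡∑ : ∀ {n ℓ} {P : Pred (Fin n) ℓ} (P? : Decidable P) → AtMostOne P →
             𝟙 (does (any? P?)) ≡ ∑[ i < n ] 𝟙 (does (P? i))
  𝟙-any?≡∑ {zero}  P? _   = refl
  𝟙-any?≡∑ {suc n} P? atMostOne with P? zero
  ... | yes P0 = cong suc (sym (trans (sum-cong-≗ none) (sum-replicate-zero n)))
    where
    none : ∀ i → 𝟙 (does (P? (suc i))) ≡ 0
    none i = cong 𝟙 (dec-false (P? (suc i)) (λ Pi → 0≢1+n (atMostOne P0 Pi)))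
  ... | no _   = 𝟙-any?≡∑ (P? ∘ suc) (λ Pi Pj → suc-injective (atMostOne Pi Pj))

  ∑-≟≡1 : ∀ {n} (w : Fin n) → ∑[ v < n ] 𝟙 (does (w ≟ v)) ≡ 1
  ∑-≟≡1 w = trans (sym (𝟙-any?≡∑ (w ≟_) (λ e e′ → trans (sym e) e′)))
                (cong 𝟙 (dec-true (any? (w ≟_)) (w , refl)))

  module Image {n N} (S : Subset n) (τ : Fin n → Fin N) where

    Preimage : Fin N → Set
    Preimage v = ∃[ i ] (i ∈ S × τ i ≡ v)

    preimage? : Decidable Preimage
    preimage? v = any? (λ i → i ∈? S ×-dec τ i ≟ v)

    image : Subset N
    image = tabulate (λ v → does (preimage? v))

    ∈image⇒ : ∀ {v} → v ∈ image → Preimage v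
    ∈image⇒ {v} v∈ with preimage? v | ∈tabulate⇒ v∈
    ... | yes p | _ = p

    ⇒∈image : ∀ {i} → i ∈ S → τ i ∈ image
    ⇒∈image {i} i∈ = ⇒∈tabulate (dec-true (preimage? (τ i)) (i , i∈ , refl))

    ∣image∣≡∣S∣ : (∀ {i j} → i ∈ S → j ∈ S → τ i ≡ τ j → i ≡ j) → ∣ image ∣ ≡ ∣ S ∣
    ∣image∣≡∣S∣ inj = begin
      ∣ image ∣                                  ≡⟨ ∣tabulate∣≡∑ (λ v → does (preimage? v)) ⟩
      ∑[ v < N ] 𝟙 (does (preimage? v))          ≡⟨ sum-cong-≗ (λ v → 𝟙-any?≡∑ _ (atMostOne v)) ⟩
      ∑[ v < N ] ∑[ i < n ] 𝟙 (does (hit? i v))  ≡⟨ ∑-comm (λ v i → 𝟙 (does (hit? i v))) ⟩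
      ∑[ i < n ] ∑[ v < N ] 𝟙 (does (hit? i v))  ≡⟨ sum-cong-≗ {n} row ⟩
      ∑[ i < n ] 𝟙 (does (i ∈? S))               ≡⟨ sym (∣p∣≡∑ S) ⟩
      ∣ S ∣                                      ∎
      where
      open ≡-Reasoning
      hit? : ∀ i v → Dec (i ∈ S × τ i ≡ v)
      hit? i v = i ∈? S ×-dec τ i ≟ v
      atMostOne : ∀ v → AtMostOne (λ i → i ∈ S × τ i ≡ v)
      atMostOne v (i∈ , e) (j∈ , e′) = inj i∈ j∈ (trans e (sym e′))
      row : ∀ i → ∑[ v < N ] 𝟙 (does (hit? i v)) ≡ 𝟙 (does (i ∈? S))
      row i with i ∈? S
      ... | yes _ = ∑-≟≡1 (τ i)
      ... | no _  = sum-replicate-zero N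

parity-even : ∀ {m} → 2 ∣ m → parity m ≡ 0ℙ
parity-even (divides q refl) = ≡.trans (*-homo-* q 2) (*-zeroʳ (parity q))

isEven : Parity → Bool
isEven 0ℙ = true
isEven 1ℙ = false

isEven-⁻¹ : ∀ p → isEven (p ℙ.⁻¹) ≡ not (isEven p)
isEven-⁻¹ 0ℙ = refl
isEven-⁻¹ 1ℙ = refl

module Argmin where
  open ≡ using (sym; trans; subst; subst₂)

  IsArgmin : (ℕ → ℕ) → ℕ → ℕ → Set
  IsArgmin g k t = t ≤ k × (∀ {j} → j ≤ k → g t ≤ g j)

  argmin : (ℕ → ℕ) → ℕ → ℕ
  argmin g zero    = zero
  argmin g (suc k) with g (suc k) <? g (argmin g k)
  ... | yes _ = suc k
  ... | no _  = argmin g k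

  argmin-isArgmin : ∀ g k → IsArgmin g k (argmin g k)
  argmin-isArgmin g zero    = z≤n , λ { z≤n → ≤-refl }
  argmin-isArgmin g (suc k) with g (suc k) <? g (argmin g k) | argmin-isArgmin g k
  ... | yes new<old | _ , old≤ = ≤-refl , minimal
    where
    minimal : ∀ {j} → j ≤ suc k → g (suc k) ≤ g j
    minimal j≤ with m≤n⇒m<n∨m≡n j≤
    ... | inj₁ (s≤s j≤k) = <⇒≤ (<-≤-trans new<old (old≤ j≤k))
    ... | inj₂ refl      = ≤-refl
  ... | no new≮old | t≤k , old≤ = m≤n⇒m≤1+n t≤k , minimal
    where
    minimal : ∀ {j} → j ≤ suc k → g (argmin g k) ≤ g j
    minimal j≤ with m≤n⇒m<n∨m≡n j≤
    ... | inj₁ (s≤s j≤k) = old≤ j≤k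
    ... | inj₂ refl      = ≮⇒≥ new≮old

  IsArgmin-resp-≗ : ∀ {g h k t} → g ≗ h → IsArgmin g k t → IsArgmin h k t
  IsArgmin-resp-≗ {t = t} g≗h (t≤k , min) =
    t≤k , λ {j} j≤k → subst₂ _≤_ (g≗h t) (g≗h j) (min j≤k)

  InjectiveUpTo : (ℕ → ℕ) → ℕ → Set
  InjectiveUpTo g k = ∀ {i j} → i ≤ k → j ≤ k → g i ≡ g j → i ≡ j

  argmin-unique : ∀ {g k t t′} → InjectiveUpTo g k →
                  IsArgmin g k t → IsArgmin g k t′ → t ≡ t′
  argmin-unique inj (t≤k , min) (t′≤k , min′) =
    inj t≤k t′≤k (≤-antisym (min t′≤k) (min′ t≤k))

  cyclicPred : ℕ → ℕ → ℕ
  cyclicPred k zero    = k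
  cyclicPred k (suc t) = t

  argmin-periodic : ∀ {g k t} → g (suc k) ≡ g 0 → IsArgmin g k t →
                    ∀ {j} → j ≤ suc k → g t ≤ g j
  argmin-periodic {g} {t = t} period (_ , min) j≤ with m≤n⇒m<n∨m≡n j≤
  ... | inj₁ (s≤s j≤k) = min j≤k
  ... | inj₂ refl      = subst (g t ≤_) (sym period) (min z≤n)

  argmin-rotate : ∀ {g k} t → g (suc k) ≡ g 0 → IsArgmin g k t →
                  IsArgmin (g ∘ suc) k (cyclicPred k t)
  argmin-rotate {g} zero period isMin =
    ≤-refl , λ {j} j≤k →
      subst (_≤ g (suc j)) (sym period) (argmin-periodic period isMin (s≤s j≤k))
  argmin-rotate (suc t) period isMin@(t<k , _) =
    <⇒≤ t<k , λ j≤k → argmin-periodic period isMin (s≤s j≤k)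

  parity-cyclicPred : ∀ k t → parity (suc k) ≡ 0ℙ → parity (cyclicPred k t) ≡ parity t ℙ.⁻¹
  parity-cyclicPred k zero    even = trans (sym (suc-homo-⁻¹ k)) (cong ℙ._⁻¹ even)
  parity-cyclicPred k (suc t) _    = sym (suc-homo-⁻¹ t)

module GroupFacts {c ℓ} (G : Group c ℓ) {n : ℕ} (enum : Enumeration G n) where
  open Group G
  open Inverse enum using (to; from; to-cong; from-cong; strictlyInverseˡ; strictlyInverseʳ)
  open import Algebra.Properties.Group G using (∙-cancelˡ; identityʳ-unique; ⁻¹-injective)
  open import Relation.Binary.Reasoning.Setoid setoid

  to-injective : ∀ {i j} → to i ≈ to j → i ≡ j
  to-injective {i} {j} eq =
    ≡.trans (≡.sym (strictlyInverseʳ i)) (≡.trans (from-cong eq) (strictlyInverseʳ j))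

  from-injective : ∀ {x y} → from x ≡ from y → x ≈ y
  from-injective {x} {y} eq =
    trans (sym (strictlyInverseˡ x)) (trans (to-cong eq) (strictlyInverseˡ y))

  private
    s : Fin n × Bool → Carrier
    s = signedElem G enum

  signedElem-inverse : ∀ i b → s (i , b) ∙ s (i , not b) ≈ ε
  signedElem-inverse i true  = inverseʳ (to i)
  signedElem-inverse i false = inverseˡ (to i)

  signedElem-cancel : ∀ x i b → (x ∙ s (i , b)) ∙ s (i , not b) ≈ x
  signedElem-cancel x i b = begin
    (x ∙ s (i , b)) ∙ s (i , not b)  ≈⟨ assoc _ _ _ ⟩
    x ∙ (s (i , b) ∙ s (i , not b))  ≈⟨ ∙-congˡ (signedElem-inverse i b) ⟩
    x ∙ ε                            ≈⟨ identityʳ x ⟩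
    x                                ∎

  infixl 7 _·_
  _·_ : Fin n → Fin n × Bool → Fin n
  h · g = from (to h ∙ s g)

  to-· : ∀ h g → to (h · g) ≈ to h ∙ s g
  to-· h g = strictlyInverseˡ _

  ·-cancel : ∀ h i b → h · (i , b) · (i , not b) ≡ h
  ·-cancel h i b =
    ≡.trans (from-cong (trans (∙-congʳ (to-· h (i , b))) (signedElem-cancel (to h) i b)))
            (strictlyInverseʳ h)

  signedElem-injective : ∀ {i j b} → s (i , b) ≈ s (j , b) → i ≡ j
  signedElem-injective {b = true}  eq = to-injective eq
  signedElem-injective {b = false} eq = to-injective (⁻¹-injective eq)

  ·-injective : ∀ h g g′ → h · g ≡ h · g′ → s g ≈ s g′
  ·-injective h _ _ eq = ∙-cancelˡ (to h) _ _ (from-injective eq)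

  ·-fixed : ∀ h g → h · g ≡ h → s g ≈ ε
  ·-fixed h _ eq =
    identityʳ-unique (to h) _ (from-injective (≡.trans eq (≡.sym (strictlyInverseʳ h))))

  module _ {S : Subset n} (dissociated : Dissociated G enum S) where
    open import Data.List.Relation.Unary.AllPairs using ([]; _∷_)

    dissociated⇒≉ε : ∀ {i} b → i ∈ S → ¬ s (i , b) ≈ ε
    dissociated⇒≉ε {i} b i∈S sᵢ≈ε =
      dissociated ((i , b) ∷ []) (s≤s z≤n) ([] ∷ []) (i∈S ∷ []) (trans (identityʳ _) sᵢ≈ε)

    dissociated⇒injective : ∀ {i j} b b′ → i ∈ S → j ∈ S → s (i , b) ≈ s (j , b′) → i ≡ j
    dissociated⇒injective {i} {j} b b′ i∈S j∈S eq with i ≟ j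
    ... | yes i≡j = i≡j
    ... | no i≢j  = ⊥-elim (dissociated ((i , b) ∷ (j , not b′) ∷ []) (s≤s z≤n)
                     ((i≢j ∷ []) ∷ [] ∷ []) (i∈S ∷ j∈S ∷ []) product≈ε)
      where
      product≈ε : s (i , b) ∙ (s (j , not b′) ∙ ε) ≈ ε
      product≈ε = trans (∙-cong eq (identityʳ _)) (signedElem-inverse j b′)

  private
    _^_ : Carrier → ℕ → Carrier
    _^_ = pow G enum

  pow-+ : ∀ g a b → g ^ (a + b) ≈ g ^ a ∙ g ^ b
  pow-+ g zero    b = sym (identityˡ _)
  pow-+ g (suc a) b = trans (∙-congˡ (pow-+ g a b)) (sym (assoc _ _ _))

  pow-distinct : ∀ {g m a b} → HasOrder G enum g m → a < b → b < m → ¬ g ^ a ≈ g ^ b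
  pow-distinct {g} {a = a} {b} (_ , _ , minimal) a<b b<m gᵃ≈gᵇ =
    minimal (b ∸ a) (m<n⇒0<n∸m a<b) (≤-<-trans (m∸n≤m b a) b<m)
      (identityʳ-unique _ _ gᵃ⁺ᵈ≈gᵃ)
    where
    gᵃ⁺ᵈ≈gᵃ : g ^ a ∙ g ^ (b ∸ a) ≈ g ^ a
    gᵃ⁺ᵈ≈gᵃ = begin
      g ^ a ∙ g ^ (b ∸ a)  ≈⟨ pow-+ g a (b ∸ a) ⟨
      g ^ (a + (b ∸ a))  ≡⟨ cong (g ^_) (m+[n∸m]≡n (<⇒≤ a<b)) ⟩
      g ^ b                ≈⟨ gᵃ≈gᵇ ⟨
      g ^ a                ∎

  pow-injective : ∀ {g m a b} → HasOrder G enum g m → a < m → b < m → g ^ a ≈ g ^ b → a ≡ b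
  pow-injective {a = a} {b} order a<m b<m eq with <-cmp a b
  ... | tri< a<b _ _ = ⊥-elim (pow-distinct order a<b b<m eq)
  ... | tri≈ _ a≡b _ = a≡b
  ... | tri> _ _ b<a = ⊥-elim (pow-distinct order b<a a<m (sym eq))

data Chain {V : Set} : V → V → List (V × V) → Set where
  stop : ∀ {a} → Chain a a []
  step : ∀ {u v b ps} → Chain v b ps → Chain u b ((u , v) ∷ ps)

module _ {N : ℕ} (Γ : ColouredGraph N) where

  cyclicPairs-closed : ∀ v rest → Chain v v (cyclicPairs Γ (v ∷ rest))
  cyclicPairs-closed v []       = step stop
  cyclicPairs-closed v (x ∷ xs) = step (closing x xs)
    where
    -- drop 1 unfolds to the local helper of cyclicPairs, which cannot be named here
    closing : ∀ x xs → Chain x v (drop 1 (cyclicPairs Γ (v ∷ x ∷ xs)))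
    closing x []       = step stop
    closing x (y ∷ ys) = step (closing y ys)

  cyclicPairs-nonEmpty : ∀ v rest → 1 ≤ length (cyclicPairs Γ (v ∷ rest))
  cyclicPairs-nonEmpty v []      = s≤s z≤n
  cyclicPairs-nonEmpty v (_ ∷ _) = s≤s z≤n

record LabelledMatchings {c ℓ} (G : Group c ℓ) {n : ℕ} (enum : Enumeration G n)
                         (S : Subset n) (N : ℕ) : Set (c ⊔ ℓ) where
  open Group G using (Carrier; _≈_; _∙_)
  field
    match              : Fin n → Fin N → Fin N
    sign               : Fin n → Fin N → Bool
    label              : Fin N → Carrier
    match-involutive   : ∀ {i} v → i ∈ S → match i (match i v) ≡ v
    match-fixpointFree : ∀ {i} v → i ∈ S → match i v ≢ v
    match-injective    : ∀ {i j} v → i ∈ S → j ∈ S → match i v ≡ match j v → i ≡ j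
    label-match        : ∀ {i} v → i ∈ S →
                         label (match i v) ≈ label v ∙ signedElem G enum (i , sign i v)

module MatchingGraph {c ℓ} {G : Group c ℓ} {n : ℕ} {enum : Enumeration G n} {S : Subset n}
                     {N : ℕ} (M : LabelledMatchings G enum S N) where
  open LabelledMatchings M
  open Group G hiding (refl)
  open Counting using (module Image)
  open import Algebra.Properties.Group G using (identityʳ-unique)
  open import Relation.Binary.Reasoning.Setoid setoid

  Matches : Fin N → Fin N → Fin n → Set
  Matches u v i = i ∈ S × match i u ≡ v

  module Neighbours (u : Fin N) = Image S (λ i → match i u)
  open Neighbours using (preimage?; ∈image⇒; ⇒∈image)

  adj : Fin N → Subset N
  adj = Neighbours.image

  colour : Fin N → Fin N → ℕ
  colour u v with preimage? u v
  ... | yes (i , _) = toℕ i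
  ... | no _        = 0

  colour-match : ∀ {u v} (w : ∃[ i ] Matches u v i) → colour u v ≡ toℕ (proj₁ w)
  colour-match {u} {v} (i , i∈S , eq) with preimage? u v
  ... | yes (j , j∈S , eq′) = cong toℕ (match-injective u j∈S i∈S (≡.trans eq′ (≡.sym eq)))
  ... | no ¬w               = ⊥-elim (¬w (i , i∈S , eq))

  adj-sym : ∀ {u v} → v ∈ adj u → u ∈ adj v
  adj-sym {u} v∈ with ∈image⇒ u v∈
  ... | i , i∈S , refl =
    ≡.subst (_∈ adj (match i u)) (match-involutive u i∈S) (⇒∈image (match i u) i∈S)

  adj-irrefl : ∀ {v} → ¬ v ∈ adj v
  adj-irrefl {v} v∈ with ∈image⇒ v v∈
  ... | i , i∈S , eq = match-fixpointFree v i∈S eq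

  colour-sym : ∀ {u v} → v ∈ adj u → colour u v ≡ colour v u
  colour-sym {u} v∈ with ∈image⇒ u v∈
  ... | i , i∈S , refl = ≡.trans (colour-match (i , i∈S , refl))
                                 (≡.sym (colour-match (i , i∈S , match-involutive u i∈S)))

  graph : ColouredGraph N
  graph = record
    { adj = adj ; colour = colour
    ; adj-sym = adj-sym ; adj-irrefl = adj-irrefl ; colour-sym = colour-sym }

  graph-proper : ProperlyColoured graph
  graph-proper {u} v∈ w∈ v≢w same with ∈image⇒ u v∈ | ∈image⇒ u w∈
  ... | i , i∈S , refl | j , j∈S , refl =
    v≢w (cong (λ k → match k u) (toℕ-injective
      (≡.trans (≡.sym (colour-match (i , i∈S , refl)))
               (≡.trans same (colour-match (j , j∈S , refl))))))

  graph-regular : Regular graph ∣ S ∣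
  graph-regular u = Neighbours.∣image∣≡∣S∣ u (match-injective u)

  Adjacent : Fin N × Fin N → Set
  Adjacent e = proj₂ e ∈ adj (proj₁ e)

  edgeColour : Fin N × Fin N → ℕ
  edgeColour e = colour (proj₁ e) (proj₂ e)

  signedLabel : ∀ {u v} → ∃[ i ] Matches u v i → Fin n × Bool
  signedLabel {u} (i , _) = i , sign i u

  label-step : ∀ {u v} (w : ∃[ i ] Matches u v i) →
               label v ≈ label u ∙ signedElem G enum (signedLabel w)
  label-step {u} (i , i∈S , refl) = label-match u i∈S

  edgeLabels : ∀ {ps} → All Adjacent ps → List (Fin n × Bool)
  edgeLabels = All.reduce (λ {e} e∈ → signedLabel (∈image⇒ (proj₁ e) e∈))

  edgeLabels-∈S : ∀ {ps} (adjacent : All Adjacent ps) →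
                  All (λ x → proj₁ x ∈ S) (edgeLabels adjacent)
  edgeLabels-∈S []                               = []
  edgeLabels-∈S {(u , _) ∷ _} (e∈ ∷ adjacent) =
    proj₁ (proj₂ (∈image⇒ u e∈)) ∷ edgeLabels-∈S adjacent

  edgeLabels-colours : ∀ {ps} (adjacent : All Adjacent ps) →
                       map edgeColour ps ≡ map toℕ (map proj₁ (edgeLabels adjacent))
  edgeLabels-colours []                             = refl
  edgeLabels-colours {(u , _) ∷ _} (e∈ ∷ adjacent) =
    ≡.cong₂ _∷_ (colour-match (∈image⇒ u e∈)) (edgeLabels-colours adjacent)

  chain-label : ∀ {a b ps} → Chain a b ps → (adjacent : All Adjacent ps) →
                label b ≈ label a ∙ signedProduct G enum (edgeLabels adjacent)
  chain-label stop []                                  = sym (identityʳ _)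
  chain-label (step {u} {v} {b} chain) (e∈ ∷ adjacent) = begin
    label b                                 ≈⟨ chain-label chain adjacent ⟩
    label v ∙ rest                          ≈⟨ ∙-congʳ (label-step (∈image⇒ u e∈)) ⟩
    (label u ∙ signedElem G enum x) ∙ rest  ≈⟨ assoc _ _ _ ⟩
    label u ∙ (signedElem G enum x ∙ rest)  ∎
    where
    x : Fin n × Bool
    x = signedLabel (∈image⇒ u e∈)
    rest : Carrier
    rest = signedProduct G enum (edgeLabels adjacent)

  module _ (dissociated : Dissociated G enum S) where

    closedChain-notRainbow : ∀ {v ps} → Chain v v ps → 1 ≤ length ps →
                             (adjacent : All Adjacent ps) → ¬ Unique (map edgeColour ps)
    closedChain-notRainbow {ps = []}    _     () _
    closedChain-notRainbow {v} {_ ∷ _} chain _  adjacent@(_ ∷ _) rainbow =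
      dissociated (edgeLabels adjacent) (s≤s z≤n) distinct (edgeLabels-∈S adjacent)
        (identityʳ-unique (label v) _ (sym (chain-label chain adjacent)))
      where
      distinct : Unique (map proj₁ (edgeLabels adjacent))
      distinct = Unique.map⁻ (≡.subst Unique (edgeLabels-colours adjacent) rainbow)

    graph-noRainbowCycle : NoRainbowCycle graph
    graph-noRainbowCycle []         (() , _)
    graph-noRainbowCycle (v ∷ rest) (_ , _ , adjacent) =
      closedChain-notRainbow (cyclicPairs-closed graph v rest)
                             (cyclicPairs-nonEmpty graph v rest) adjacent

    goodGraph : GoodGraph N ∣ S ∣
    goodGraph = graph , graph-proper , graph-regular , graph-noRainbowCycle

module DoubleCover {c ℓ} (G : Group c ℓ) {n : ℕ} (enum : Enumeration G n) (S : Subset n) where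
  open Group G hiding (refl)
  open Inverse enum using (to)
  open GroupFacts G enum
  open ≡.≡-Reasoning

  vertices : Fin (2 * n) ↔ (Bool × Fin n)
  vertices = ↔-trans *↔× (2↔Bool ×-↔ ↔-refl)

  open Inverse vertices using ()
    renaming ( to to decode; from to encode
             ; strictlyInverseˡ to decode-encode; strictlyInverseʳ to encode-decode)

  cross : Fin n → Bool × Fin n → Bool × Fin n
  cross i (b , h) = not b , h · (i , b)

  cross-involutive : ∀ i p → cross i (cross i p) ≡ p
  cross-involutive i (b , h) = ≡.cong₂ _,_ (not-involutive b) (·-cancel h i b)

  cross-injective : ∀ {i j} p → cross i p ≡ cross j p → i ≡ j
  cross-injective {i} {j} (b , h) eq =
    signedElem-injective {b = b} (·-injective h (i , b) (j , b) (cong proj₂ eq))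

  match : Fin n → Fin (2 * n) → Fin (2 * n)
  match i v = encode (cross i (decode v))

  decode-match : ∀ i v → decode (match i v) ≡ cross i (decode v)
  decode-match i v = decode-encode (cross i (decode v))

  match-involutive : ∀ {i} v → i ∈ S → match i (match i v) ≡ v
  match-involutive {i} v _ = begin
    encode (cross i (decode (match i v)))  ≡⟨ cong (encode ∘ cross i) (decode-match i v) ⟩
    encode (cross i (cross i (decode v)))  ≡⟨ cong encode (cross-involutive i (decode v)) ⟩
    encode (decode v)                      ≡⟨ encode-decode v ⟩
    v                                      ∎

  match-fixpointFree : ∀ {i} v → i ∈ S → match i v ≢ v
  match-fixpointFree {i} v _ eq =
    not-¬ refl (≡.sym (cong proj₁ (≡.trans (≡.sym (decode-match i v)) (cong decode eq))))

  match-injective : ∀ {i j} v → i ∈ S → j ∈ S → match i v ≡ match j v → i ≡ j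
  match-injective {i} {j} v _ _ eq =
    cross-injective (decode v) (begin
      cross i (decode v)  ≡⟨ decode-match i v ⟨
      decode (match i v)  ≡⟨ cong decode eq ⟩
      decode (match j v)  ≡⟨ decode-match j v ⟩
      cross j (decode v)  ∎)

  matchings : LabelledMatchings G enum S (2 * n)
  matchings = record
    { match              = match
    ; sign               = λ _ v → proj₁ (decode v)
    ; label              = λ v → to (proj₂ (decode v))
    ; match-involutive   = match-involutive
    ; match-fixpointFree = match-fixpointFree
    ; match-injective    = match-injective
    ; label-match        = λ {i} v _ →
        trans (reflexive (cong (to ∘ proj₂) (decode-match i v)))
              (to-· (proj₂ (decode v)) (i , proj₁ (decode v)))
    }

module Alternating {c ℓ} (G : Group c ℓ) {n : ℕ} (enum : Enumeration G n)
                   (s : Group.Carrier G) (k : ℕ) where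
  open Group G hiding (refl)
  open Inverse enum using (from; from-cong)
  open GroupFacts G enum
  open Argmin
  open import Algebra.Properties.Group G using (∙-cancelˡ; //-rightDividesˡ)

  -- Under right multiplication by s (of order suc k) the coset x⟨s⟩ is the cycle
  -- x, x s, …, x sᵏ.  position x is the exponent at which this cycle meets its
  -- element of least index; it drops by one (cyclically) when x is replaced by x s,
  -- so for even suc k its parity alternates along the cycle.
  key : Carrier → ℕ → ℕ
  key x j = toℕ (from (x ∙ pow G enum s j))

  position : Carrier → ℕ
  position x = argmin (key x) k

  colour : Carrier → Bool
  colour x = isEven (parity (position x))

  module _ (order : HasOrder G enum s (suc k)) where

    key-injective : ∀ x → InjectiveUpTo (key x) k
    key-injective x i≤k j≤k eq =
      pow-injective order (s≤s i≤k) (s≤s j≤k) (∙-cancelˡ x _ _ (from-injective (toℕ-injective eq)))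

    key-periodic : ∀ x → key x (suc k) ≡ key x 0
    key-periodic x = cong toℕ (from-cong (∙-congˡ (proj₁ (proj₂ order))))

    key-shift : ∀ x → key (x ∙ s) ≗ key x ∘ suc
    key-shift x j = cong toℕ (from-cong (assoc x s (pow G enum s j)))

    key-cong : ∀ {x y} → x ≈ y → key x ≗ key y
    key-cong x≈y j = cong toℕ (from-cong (∙-congʳ x≈y))

    position-isArgmin : ∀ x → IsArgmin (key x) k (position x)
    position-isArgmin x = argmin-isArgmin (key x) k

    position-cong : ∀ {x y} → x ≈ y → position x ≡ position y
    position-cong {x} {y} x≈y =
      argmin-unique (key-injective y)
        (IsArgmin-resp-≗ (key-cong x≈y) (position-isArgmin x)) (position-isArgmin y)

    position-shift : ∀ x → position (x ∙ s) ≡ cyclicPred k (position x)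
    position-shift x =
      argmin-unique (key-injective (x ∙ s)) (position-isArgmin (x ∙ s))
        (IsArgmin-resp-≗ (≡.sym ∘ key-shift x)
          (argmin-rotate (position x) (key-periodic x) (position-isArgmin x)))

    colour-cong : ∀ {x y} → x ≈ y → colour x ≡ colour y
    colour-cong x≈y = cong (isEven ∘ parity) (position-cong x≈y)

    module _ (even : 2 ∣ suc k) where

      colour-shift : ∀ x → colour (x ∙ s) ≡ not (colour x)
      colour-shift x = begin
        isEven (parity (position (x ∙ s)))  ≡⟨ cong (isEven ∘ parity) (position-shift x) ⟩
        isEven (parity (cyclicPred k t))    ≡⟨ cong isEven (parity-cyclicPred k t (parity-even even)) ⟩
        isEven (parity t ℙ.⁻¹)              ≡⟨ isEven-⁻¹ (parity t) ⟩
        not (isEven (parity t))             ∎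
        where
        open ≡.≡-Reasoning
        t : ℕ
        t = position x

      colour-shift⁻¹ : ∀ x → colour (x ∙ s ⁻¹) ≡ not (colour x)
      colour-shift⁻¹ x = ≡.trans (≡.sym (not-involutive _)) (cong not (≡.sym (begin
        colour x                  ≡⟨ colour-cong (//-rightDividesˡ s x) ⟨
        colour ((x ∙ s ⁻¹) ∙ s)   ≡⟨ colour-shift (x ∙ s ⁻¹) ⟩
        not (colour (x ∙ s ⁻¹))   ∎)))
        where open ≡.≡-Reasoning

module EvenCover {c ℓ} (G : Group c ℓ) {n : ℕ} (enum : Enumeration G n) (S : Subset n)
                 (dissociated : Dissociated G enum S) (allEven : AllEvenOrder G enum S) where
  open Group G hiding (refl)
  open Inverse enum using (to)
  open GroupFacts G enum

  predOrder : Fin n → ℕ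
  predOrder i with i ∈? S
  ... | yes i∈S = pred (proj₁ (allEven i i∈S))
  ... | no _    = 0

  predOrder-spec : ∀ {i} → i ∈ S →
                   HasOrder G enum (to i) (suc (predOrder i)) × 2 ∣ suc (predOrder i)
  predOrder-spec {i} i∈S with i ∈? S
  ... | no i∉S = ⊥-elim (i∉S i∈S)
  ... | yes i∈S′ with allEven i i∈S′
  ...   | suc _ , order , even = order , even

  module Colouring (i : Fin n) = Alternating G enum (to i) (predOrder i)

  colour : Fin n → Carrier → Bool
  colour = Colouring.colour

  colour-step : ∀ {i} x b → i ∈ S → colour i (x ∙ signedElem G enum (i , b)) ≡ not (colour i x)
  colour-step {i} x true  i∈S =
    Colouring.colour-shift i (proj₁ (predOrder-spec i∈S)) (proj₂ (predOrder-spec i∈S)) x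
  colour-step {i} x false i∈S =
    Colouring.colour-shift⁻¹ i (proj₁ (predOrder-spec i∈S)) (proj₂ (predOrder-spec i∈S)) x

  match : Fin n → Fin n → Fin n
  match i v = v · (i , colour i (to v))

  match-involutive : ∀ {i} v → i ∈ S → match i (match i v) ≡ v
  match-involutive {i} v i∈S = begin
    v · (i , b) · (i , colour i (to (v · (i , b))))  ≡⟨ cong (λ b′ → v · (i , b) · (i , b′)) flipped ⟩
    v · (i , b) · (i , not b)                        ≡⟨ ·-cancel v i b ⟩
    v                                                ∎
    where
    open ≡.≡-Reasoning
    b : Bool
    b = colour i (to v)
    flipped : colour i (to (v · (i , b))) ≡ not b
    flipped = ≡.trans (Colouring.colour-cong i (proj₁ (predOrder-spec i∈S)) (to-· v (i , b)))
                      (colour-step (to v) b i∈S)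

  matchings : LabelledMatchings G enum S n
  matchings = record
    { match              = match
    ; sign               = λ i v → colour i (to v)
    ; label              = to
    ; match-involutive   = match-involutive
    ; match-fixpointFree = λ {i} v i∈S eq →
        dissociated⇒≉ε dissociated (colour i (to v)) i∈S (·-fixed v (i , colour i (to v)) eq)
    ; match-injective    = λ {i} {j} v i∈S j∈S eq →
        dissociated⇒injective dissociated (colour i (to v)) (colour j (to v)) i∈S j∈S
          (·-injective v (i , colour i (to v)) (j , colour j (to v)) eq)
    ; label-match        = λ {i} v _ → to-· v (i , colour i (to v))
    }

mainTheorem11 : ∀ {c ℓ} (G : Group c ℓ) (n : ℕ) (enum : Enumeration G n) (S : Subset n)
    → Dissociated G enum S
    → GoodGraph (2 * n) ∣ S ∣ × (AllEvenOrder G enum S → GoodGraph n ∣ S ∣)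
mainTheorem11 G n enum S dissociated =
  MatchingGraph.goodGraph (DoubleCover.matchings G enum S) dissociated ,
  λ allEven →
    MatchingGraph.goodGraph (EvenCover.matchings G enum S dissociated allEven) dissociated
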